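{- For $n\geqslant 1$, define $$B_n^{(A)}(x,y,s,t,p,q)=\sum_{\sigma\in\mathcal{S}^B_n}x^{\mathrm{exc}_A(\sigma)}y^{\mathrm{aexc}_A(\sigma)}s^{\mathrm{single}(\sigma)}t^{\mathrm{fix}(\sigma)}p^{\mathrm{neg}(\sigma)}q^{\mathrm{cyc}(\sigma)}.$$ Then $$B_n^{(A)}(x,y,s,t,p,q)=\sum_{\pi\in\mathcal{S}_n}(x+py)^{\mathrm{exc}(\pi)}(y+py)^{\mathrm{drop}(\pi)}(t+sp)^{\mathrm{fix}(\pi)}q^{\mathrm{cyc}(\pi)},$$ equivalently $$B_n^{(A)}(x,y,s,t,p,q)=(1+p)^ny^nA_n\left(\frac{x+py}{y+py},\frac{t+sp}{y+py},q\right),$$ where $A_n(x,p,q)=\sum_{\pi\in\mathcal{S}_n}x^{\mathrm{exc}(\pi)}p^{\mathrm{fix}(\pi)}q^{\mathrm{cyc}(\pi)}$.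
   Context: $\mathcal{S}^B_n$ is the group of bijections $\sigma$ of $\{\pm1,\dots,\pm n\}$ with $\sigma(-i)=-\sigma(i)$. For $\sigma\in\mathcal{S}^B_n$: $\mathrm{exc}_A(\sigma)=\#\{i\in[n]:\sigma(i)>i\}$ (integer comparison), $\mathrm{fix}(\sigma)=\#\{i:\sigma(i)=i\}$, $\mathrm{single}(\sigma)=\#\{i:\sigma(i)=-i\}$, $\mathrm{neg}(\sigma)=\#\{i:\sigma(i)<0\}$, $\mathrm{aexc}_A(\sigma)=n-\mathrm{exc}_A(\sigma)-\mathrm{fix}(\sigma)-\mathrm{single}(\sigma)$, and $\mathrm{cyc}(\sigma)$ is the number of cycles of the permutation $i\mapsto|\sigma(i)|$ of $[n]$. For $\pi\in\mathcal{S}_n$: $\mathrm{exc}(\pi)=\#\{i:\pi(i)>i\}$, $\mathrm{drop}(\pi)=\#\{i:\pi(i)<i\}$, $\mathrm{fix}(\pi)=\#\{i:\pi(i)=i\}$, $\mathrm{cyc}(\pi)$ the number of cycles. -}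

module Defs where

open import Level using (Level)
open import Data.Nat as ℕ using (ℕ; zero; suc)
open import Data.Bool using (Bool; true; false)
open import Data.Fin as Fin using (Fin; toℕ)
open import Data.Fin.Properties as FinP using ()
open import Data.Integer as ℤ using (ℤ; +_; -_)
open import Data.Integer.Properties as ℤP using ()
open import Data.Product using (_×_; _,_; proj₁; proj₂)
open import Data.List using (List; []; _∷_; [_]; map; concatMap; filter; length; foldr; allFin; upTo)
open import Data.Vec as Vec using (Vec; []; _∷_; lookup; toList)
open import Data.List.Relation.Unary.All using (All; all?)
import Data.List.Relation.Unary.Unique.DecPropositional as UniqueDec
open import Relation.Nullary using (Dec; yes; no)
open import Relation.Unary using (Decidable)
open import Relation.Binary.PropositionalEquality using (_≡_)
open import Algebra.Bundles using (CommutativeRing)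

allVecs : ∀ {a} {A : Set a} (n : ℕ) → List A → List (Vec A n)
allVecs zero    xs = [ [] ]
allVecs (suc n) xs = concatMap (λ v → map (λ x → x ∷ v) xs) (allVecs n xs)

count : ∀ {a p} {A : Set a} {P : A → Set p} → Decidable P → List A → ℕ
count P? xs = length (filter P? xs)

-- The symmetric group S_n: a permutation π of [n] = {1..n} is given by
-- its word (π(1),…,π(n)), encoded with Fin n (value k stands for k+1);
-- S_n is the list of all injective words.

Perm : ℕ → Set
Perm n = Vec (Fin n) n

module UF {n : ℕ} = UniqueDec {A = Fin n} FinP._≟_

isPerm? : ∀ {n} → Decidable (λ (w : Perm n) → UF.Unique {n} (toList w))
isPerm? w = UF.unique? (toList w)

Sn : (n : ℕ) → List (Perm n)
Sn n = filter isPerm? (allVecs n (allFin n))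

iter : ∀ {n} → Perm n → ℕ → Fin n → Fin n
iter π zero    i = i
iter π (suc k) i = lookup π (iter π k i)

-- i is the smallest element of its cycle  (every cycle has exactly one
-- such element, so these count the cycles)
cycMin? : ∀ {n} (π : Perm n) → Decidable (λ i → All (λ k → i Fin.≤ iter π k i) (upTo n))
cycMin? {n} π i = all? (λ k → i Fin.≤? iter π k i) (upTo n)

cyc : ∀ {n} → Perm n → ℕ
cyc {n} π = count (cycMin? π) (allFin n)

exc drop fix : ∀ {n} → Perm n → ℕ
exc  {n} π = count (λ i → i Fin.<? lookup π i) (allFin n)
drop {n} π = count (λ i → lookup π i Fin.<? i) (allFin n)
fix  {n} π = count (λ i → lookup π i FinP.≟ i) (allFin n)

-- A signed permutation σ is determined
-- by (σ(1),…,σ(n)) (as σ(-i) = -σ(i)); σ(i) is encoded as a pair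
-- (|σ(i)|, negative?) .  σ is a bijection iff i ↦ |σ(i)| is one.

SPerm : ℕ → Set
SPerm n = Vec (Fin n × Bool) n

absPerm : ∀ {n} → SPerm n → Perm n
absPerm = Vec.map proj₁

SBn : (n : ℕ) → List (SPerm n)
SBn n = filter (λ σ → isPerm? (absPerm σ))
          (allVecs n (concatMap (λ k → (k , false) ∷ (k , true) ∷ []) (allFin n)))

idx : ∀ {n} → Fin n → ℤ
idx i = + suc (toℕ i)

val : ∀ {n} → SPerm n → Fin n → ℤ
val σ i with lookup σ i
... | (k , false) = + suc (toℕ k)
... | (k , true)  = - (+ suc (toℕ k))

excA fixB single neg aexcA cycB : ∀ {n} → SPerm n → ℕ
excA   {n} σ = count (λ i → idx i ℤ.<? val σ i) (allFin n)
fixB   {n} σ = count (λ i → val σ i ℤP.≟ idx i) (allFin n)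
single {n} σ = count (λ i → val σ i ℤP.≟ - idx i) (allFin n)
neg    {n} σ = count (λ i → val σ i ℤ.<? + 0) (allFin n)
aexcA  {n} σ = n ℕ.∸ excA σ ℕ.∸ fixB σ ℕ.∸ single σ
cycB       σ = cyc (absPerm σ)

module RingOps {c ℓ} (R : CommutativeRing c ℓ) where
  open CommutativeRing R

  pow : Carrier → ℕ → Carrier
  pow x zero    = 1#
  pow x (suc k) = x * pow x k

  sumL : ∀ {a} {A : Set a} → (A → Carrier) → List A → Carrier
  sumL f = foldr (λ a acc → f a + acc) 0#

  BnA : (n : ℕ) (x y s t p q : Carrier) → Carrier
  BnA n x y s t p q = sumL (λ σ →
      pow x (excA σ) * pow y (aexcA σ) * pow s (single σ) *
      pow t (fixB σ) * pow p (neg σ) * pow q (cycB σ)) (SBn n)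

  RHS : (n : ℕ) (x y s t p q : Carrier) → Carrier
  RHS n x y s t p q = sumL (λ π →
      pow (x + p * y) (exc π) * pow (y + p * y) (drop π) *
      pow (t + s * p) (fix π) * pow q (cyc π)) (Sn n)

-- Every statistic of σ counts the positions i at which a condition on (i, σ(i)) holds, so the
-- weight of σ is a product over positions of a local weight depending only on i, |σ(i)| and the
-- sign of σ(i), while cyc only sees |σ|.  Summing over the 2ⁿ sign choices with |σ| = π fixed
-- therefore replaces each local weight by the sum of its two signed versions, which is
-- x + py, y + py or t + sp according as π(i) > i, π(i) < i or π(i) = i.
module Submission where

open import Defs
open import Data.Nat using (ℕ; _≥_)
open import Algebra.Bundles using (CommutativeRing)
import Data.Nat as Nat
import Data.Nat.Properties as ℕP
open import Data.Bool using (Bool; true; false; not; _∧_; if_then_else_)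
open import Data.Empty using (⊥-elim)
open import Data.Fin as Fin using (Fin; toℕ)
import Data.Fin.Properties as FinP
open import Data.Integer as ℤ using (ℤ; -[1+_])
import Data.Integer.Properties as ℤP
open import Data.List using (List; []; _∷_; _++_; map; concatMap; filter; length; tabulate; allFin)
import Data.List.Properties as ListP
open import Data.Product using (_×_; _,_; proj₁)
open import Data.Vec as Vec using (Vec; _∷_; lookup)
open import Function using (_∘_; mk⇔)
open import Relation.Binary using (tri<; tri≈; tri>)
open import Relation.Binary.PropositionalEquality as ≡ using (_≡_; _≢_)
open import Relation.Nullary using (¬_; does; yes; no)
open import Relation.Nullary.Decidable using (¬?; _×-dec_; dec-true; dec-false; does-⇔)
open import Relation.Unary using (Pred; Decidable)

module _ {a p} {A : Set a} {E F S : Pred A p}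
         (E? : Decidable E) (F? : Decidable F) (S? : Decidable S) where

  none? : Decidable (λ a → ¬ E a × ¬ F a × ¬ S a)
  none? a = ¬? (E? a) ×-dec ¬? (F? a) ×-dec ¬? (S? a)

  module _ (E⇒¬F : ∀ {a} → E a → ¬ F a) (E⇒¬S : ∀ {a} → E a → ¬ S a) (F⇒¬S : ∀ {a} → F a → ¬ S a) where

    count-partition : ∀ l → count E? l Nat.+ (count F? l Nat.+ (count S? l Nat.+ count none? l)) ≡ length l
    count-partition []      = ≡.refl
    count-partition (a ∷ l) with E? a | F? a | S? a
    ... | yes e | yes f | _     = ⊥-elim (E⇒¬F e f)
    ... | yes e | no _  | yes s = ⊥-elim (E⇒¬S e s)
    ... | no _  | yes f | yes s = ⊥-elim (F⇒¬S f s)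
    ... | yes _ | no _  | no _  = ≡.cong Nat.suc (count-partition l)
    ... | no _  | yes _ | no _  = ≡.trans (ℕP.+-suc _ _) (≡.cong Nat.suc (count-partition l))
    ... | no _  | no _  | yes _ =
      ≡.trans (≡.cong (count E? l Nat.+_) (ℕP.+-suc _ _))
              (≡.trans (ℕP.+-suc _ _) (≡.cong Nat.suc (count-partition l)))
    ... | no _  | no _  | no _  =
      ≡.trans (≡.cong (λ k → count E? l Nat.+ (count F? l Nat.+ k)) (ℕP.+-suc _ _))
              (≡.trans (≡.cong (count E? l Nat.+_) (ℕP.+-suc _ _))
                       (≡.trans (ℕP.+-suc _ _) (≡.cong Nat.suc (count-partition l))))

    count-none : ∀ l → length l Nat.∸ count E? l Nat.∸ count F? l Nat.∸ count S? l ≡ count none? l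
    count-none l = begin
      length l ∸ cE ∸ cF ∸ cS                ≡⟨ ≡.cong (λ k → k ∸ cE ∸ cF ∸ cS) (count-partition l) ⟨
      cE + (cF + (cS + cN)) ∸ cE ∸ cF ∸ cS  ≡⟨ ≡.cong (λ k → k ∸ cF ∸ cS) (ℕP.m+n∸m≡n cE _) ⟩
      cF + (cS + cN) ∸ cF ∸ cS              ≡⟨ ≡.cong (_∸ cS) (ℕP.m+n∸m≡n cF _) ⟩
      cS + cN ∸ cS                          ≡⟨ ℕP.m+n∸m≡n cS cN ⟩
      cN                                    ∎
      where
      open ≡.≡-Reasoning
      open Nat using (_+_; _∸_)
      cE cF cS cN : ℕ
      cE = count E? l
      cF = count F? l
      cS = count S? l
      cN = count none? l

idx-injective : ∀ {n} {i k : Fin n} → idx i ≡ idx k → i ≡ k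
idx-injective = FinP.toℕ-injective ∘ ℕP.suc-injective ∘ ℤP.+-injective

idx-cancel-< : ∀ {n} {i k : Fin n} → idx i ℤ.< idx k → i Fin.< k
idx-cancel-< = Nat.s<s⁻¹ ∘ ℤP.drop‿+<+

idx-mono-< : ∀ {n} {i k : Fin n} → i Fin.< k → idx i ℤ.< idx k
idx-mono-< = ℤ.+<+ ∘ Nat.s<s

positive≢negative : ∀ {m k} → ℤ.+ m ≢ -[1+ k ]
positive≢negative ()

data ExactlyOne : Bool → Bool → Bool → Set where
  first  : ExactlyOne true false false
  second : ExactlyOne false true false
  third  : ExactlyOne false false true

exactlyOne-<-≡-> : ∀ {n} (i k : Fin n) → ExactlyOne (does (i Fin.<? k)) (does (k Fin.≟ i)) (does (k Fin.<? i))
exactlyOne-<-≡-> i k with FinP.<-cmp i k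
... | tri< i<k i≢k k≮i
  rewrite dec-true (i Fin.<? k) i<k | dec-false (k Fin.≟ i) (i≢k ∘ ≡.sym) | dec-false (k Fin.<? i) k≮i = first
... | tri≈ i≮k i≡k k≮i
  rewrite dec-false (i Fin.<? k) i≮k | dec-true (k Fin.≟ i) (≡.sym i≡k) | dec-false (k Fin.<? i) k≮i = second
... | tri> i≮k i≢k k<i
  rewrite dec-false (i Fin.<? k) i≮k | dec-false (k Fin.≟ i) (i≢k ∘ ≡.sym) | dec-true (k Fin.<? i) k<i = third

module _ {c ℓ} (R : CommutativeRing c ℓ) where
  open CommutativeRing R
  open RingOps R
  open import Relation.Binary.Reasoning.Setoid setoid
  open import Algebra.Properties.CommutativeMonoid.Sum *-commutativeMonoid
    using (sum-cong-≗) renaming (sum to ∏; sum-cong-≋ to ∏-cong; ∑-distrib-+ to ∏-distrib-*)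
  open import Algebra.Solver.Ring.NaturalCoefficients.Default commutativeSemiring
    using (solve; _:+_; _:*_; _:=_; con)

  _^ᵇ_ : Carrier → Bool → Carrier
  v ^ᵇ b = if b then v else 1#

  _when_ : Carrier → Bool → Carrier
  v when b = if b then v else 0#

  when-* : ∀ b u v → (u * v) when b ≈ (v when b) * u
  when-* true  u v = *-comm u v
  when-* false u v = sym (zeroˡ u)

  sumL-cong : ∀ {a} {A : Set a} {f g : A → Carrier} l → (∀ a → f a ≈ g a) → sumL f l ≈ sumL g l
  sumL-cong []      f≈g = refl
  sumL-cong (a ∷ l) f≈g = +-cong (f≈g a) (sumL-cong l f≈g)

  sumL-++ : ∀ {a} {A : Set a} (f : A → Carrier) l k → sumL f (l ++ k) ≈ sumL f l + sumL f k
  sumL-++ f []      k = sym (+-identityˡ _)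
  sumL-++ f (a ∷ l) k = trans (+-congˡ (sumL-++ f l k)) (sym (+-assoc _ _ _))

  sumL-concatMap : ∀ {a b} {A : Set a} {B : Set b} (f : B → Carrier) (g : A → List B) l →
                   sumL f (concatMap g l) ≈ sumL (sumL f ∘ g) l
  sumL-concatMap f g []      = refl
  sumL-concatMap f g (a ∷ l) = trans (sumL-++ f (g a) (concatMap g l)) (+-congˡ (sumL-concatMap f g l))

  sumL-map : ∀ {a b} {A : Set a} {B : Set b} (f : B → Carrier) (g : A → B) l →
             sumL f (map g l) ≡ sumL (f ∘ g) l
  sumL-map f g []      = ≡.refl
  sumL-map f g (a ∷ l) = ≡.cong (f (g a) +_) (sumL-map f g l)

  sumL-*ˡ : ∀ {a} {A : Set a} c (f : A → Carrier) l → sumL (λ a → c * f a) l ≈ c * sumL f l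
  sumL-*ˡ c f []      = sym (zeroʳ c)
  sumL-*ˡ c f (a ∷ l) = trans (+-congˡ (sumL-*ˡ c f l)) (sym (distribˡ c _ _))

  sumL-*ʳ : ∀ {a} {A : Set a} c (f : A → Carrier) l → sumL (λ a → f a * c) l ≈ sumL f l * c
  sumL-*ʳ c f []      = sym (zeroˡ c)
  sumL-*ʳ c f (a ∷ l) = trans (+-congˡ (sumL-*ʳ c f l)) (sym (distribʳ c _ _))

  sumL-*-assocʳ : ∀ {a} {A : Set a} c (f g : A → Carrier) l →
                  sumL (λ a → f a * (g a * c)) l ≈ sumL (λ a → f a * g a) l * c
  sumL-*-assocʳ c f g l = trans (sumL-cong l (λ a → sym (*-assoc _ _ _))) (sumL-*ʳ c _ l)

  sumL-filter : ∀ {a p} {A : Set a} {P : Pred A p} (P? : Decidable P) (f : A → Carrier) l →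
                sumL f (filter P? l) ≈ sumL (λ a → f a when does (P? a)) l
  sumL-filter P? f []      = refl
  sumL-filter P? f (a ∷ l) with P? a
  ... | yes _ = +-congˡ (sumL-filter P? f l)
  ... | no  _ = trans (sumL-filter P? f l) (sym (+-identityˡ _))

  pow-count-tabulate : ∀ {a p} {A : Set a} {P : Pred A p} (P? : Decidable P) v {m} (f : Fin m → A) →
                       pow v (count P? (tabulate f)) ≈ ∏ (λ i → v ^ᵇ does (P? (f i)))
  pow-count-tabulate P? v {Nat.zero}  f = refl
  pow-count-tabulate P? v {Nat.suc m} f with P? (f Fin.zero)
  ... | yes _ = *-congˡ (pow-count-tabulate P? v (f ∘ Fin.suc))
  ... | no  _ = trans (pow-count-tabulate P? v (f ∘ Fin.suc)) (sym (*-identityˡ _))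

  pow-count-allFin : ∀ {p} {n} {P : Pred (Fin n) p} (P? : Decidable P) v →
                     pow v (count P? (allFin n)) ≈ ∏ (λ i → v ^ᵇ does (P? i))
  pow-count-allFin P? v = pow-count-tabulate P? v (λ i → i)

  sumL-pairs : ∀ {a b} {A : Set a} {B : Set b} (f : A × B → Carrier) as bs →
               sumL f (concatMap (λ a → map (a ,_) bs) as) ≈ sumL (λ a → sumL (λ b → f (a , b)) bs) as
  sumL-pairs f as bs =
    trans (sumL-concatMap f _ as) (sumL-cong as (λ a → reflexive (sumL-map f (a ,_) bs)))

  -- Induction on m: the sum over the first letter, together with its weight w zero, is absorbed
  -- into the function H₀ of the remaining letters, which depends on their first components only.
  sumL-allVecs-pairs : ∀ {a b} {A : Set a} {B : Set b} (as : List A) (bs : List B) m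
    (H : Vec A m → Carrier) (w : Fin m → A × B → Carrier) →
    sumL (λ σ → H (Vec.map proj₁ σ) * ∏ (λ i → w i (lookup σ i))) (allVecs m (concatMap (λ a → map (a ,_) bs) as))
      ≈ sumL (λ v → H v * ∏ (λ i → sumL (λ b → w i (lookup v i , b)) bs)) (allVecs m as)
  sumL-allVecs-pairs as bs Nat.zero    H w = refl
  sumL-allVecs-pairs {A = A} {B} as bs (Nat.suc m) H w = begin
    sumL Φ (concatMap (λ σ → map (_∷ σ) ps) (allVecs m ps))
      ≈⟨ sumL-concatMap Φ _ (allVecs m ps) ⟩
    sumL (λ σ → sumL Φ (map (_∷ σ) ps)) (allVecs m ps)
      ≈⟨ sumL-cong (allVecs m ps) extend-signed ⟩
    sumL (λ σ → H₀ (Vec.map proj₁ σ) * ∏ (λ i → w (Fin.suc i) (lookup σ i))) (allVecs m ps)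
      ≈⟨ sumL-allVecs-pairs as bs m H₀ (w ∘ Fin.suc) ⟩
    sumL (λ v → H₀ v * ∏ (λ i → W (Fin.suc i) (lookup v i))) (allVecs m as)
      ≈⟨ sumL-cong (allVecs m as) extend-unsigned ⟨
    sumL (λ v → sumL Ψ (map (_∷ v) as)) (allVecs m as)
      ≈⟨ sumL-concatMap Ψ _ (allVecs m as) ⟨
    sumL Ψ (concatMap (λ v → map (_∷ v) as) (allVecs m as))
      ∎
    where
    ps : List (A × B)
    ps = concatMap (λ a → map (a ,_) bs) as
    W : Fin (Nat.suc m) → A → Carrier
    W i a = sumL (λ b → w i (a , b)) bs
    Φ : Vec (A × B) (Nat.suc m) → Carrier
    Φ σ = H (Vec.map proj₁ σ) * ∏ (λ i → w i (lookup σ i))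
    Ψ : Vec A (Nat.suc m) → Carrier
    Ψ v = H v * ∏ (λ i → W i (lookup v i))
    H₀ : Vec A m → Carrier
    H₀ u = sumL (λ a → H (a ∷ u) * W Fin.zero a) as

    extend-signed : ∀ σ → sumL Φ (map (_∷ σ) ps) ≈ H₀ (Vec.map proj₁ σ) * ∏ (λ i → w (Fin.suc i) (lookup σ i))
    extend-signed σ = begin
      sumL Φ (map (_∷ σ) ps)                                             ≡⟨ sumL-map Φ (_∷ σ) ps ⟩
      sumL (λ e → Φ (e ∷ σ)) ps                                          ≈⟨ sumL-pairs (λ e → Φ (e ∷ σ)) as bs ⟩
      sumL (λ a → sumL (λ b → H (a ∷ u) * (w Fin.zero (a , b) * P)) bs) as
        ≈⟨ sumL-cong as (λ a → trans (sumL-*-assocʳ P _ _ bs) (*-congʳ (sumL-*ˡ (H (a ∷ u)) _ bs))) ⟩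
      sumL (λ a → H (a ∷ u) * W Fin.zero a * P) as                       ≈⟨ sumL-*ʳ P _ as ⟩
      H₀ u * P                                                           ∎
      where
      u : Vec A m
      u = Vec.map proj₁ σ
      P : Carrier
      P = ∏ (λ i → w (Fin.suc i) (lookup σ i))

    extend-unsigned : ∀ v → sumL Ψ (map (_∷ v) as) ≈ H₀ v * ∏ (λ i → W (Fin.suc i) (lookup v i))
    extend-unsigned v = trans (reflexive (sumL-map Ψ (_∷ v) as)) (sumL-*-assocʳ _ _ _ as)

  module _ (x y s t p q : Carrier) where

    positionWeight : (above fixed opposite negative : Bool) → Carrier
    positionWeight above fixed opposite negative =
      x ^ᵇ above * y ^ᵇ (not above ∧ (not fixed ∧ not opposite)) * s ^ᵇ opposite * t ^ᵇ fixed * p ^ᵇ negative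

    weightAt : ∀ {n} → Fin n → ℤ → Carrier
    weightAt i v = positionWeight (does (idx i ℤ.<? v)) (does (v ℤ.≟ idx i)) (does (v ℤ.≟ ℤ.- idx i)) (does (v ℤ.<? ℤ.+ 0))

    statistics-product : ∀ {n} (σ : SPerm n) →
      pow x (excA σ) * pow y (aexcA σ) * pow s (single σ) * pow t (fixB σ) * pow p (neg σ)
        ≈ ∏ (λ i → weightAt i (val σ i))
    statistics-product {n} σ = begin
      pow x (excA σ) * pow y (aexcA σ) * pow s (single σ) * pow t (fixB σ) * pow p (neg σ)
        ≡⟨ ≡.cong (λ k → pow x (excA σ) * pow y k * pow s (single σ) * pow t (fixB σ) * pow p (neg σ)) aexcA≡count ⟩
      pow x (excA σ) * pow y (count O? (allFin n)) * pow s (single σ) * pow t (fixB σ) * pow p (neg σ)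
        ≈⟨ *-cong (*-cong (*-cong (*-cong (pow-count-allFin E? x) (pow-count-allFin O? y))
                  (pow-count-allFin S? s)) (pow-count-allFin F? t)) (pow-count-allFin N? p) ⟩
      _ ≈⟨ *-congʳ (*-congʳ (*-congʳ (∏-distrib-* {n} _ _))) ⟨
      _ ≈⟨ *-congʳ (*-congʳ (∏-distrib-* {n} _ _)) ⟨
      _ ≈⟨ *-congʳ (∏-distrib-* {n} _ _) ⟨
      _ ≈⟨ ∏-distrib-* {n} _ _ ⟨
      ∏ (λ i → weightAt i (val σ i)) ∎
      where
      E? : Decidable (λ i → idx i ℤ.< val σ i)
      E? i = idx i ℤ.<? val σ i
      F? : Decidable (λ i → val σ i ≡ idx i)
      F? i = val σ i ℤ.≟ idx i
      S? : Decidable (λ i → val σ i ≡ ℤ.- idx i)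
      S? i = val σ i ℤ.≟ ℤ.- idx i
      N? : Decidable (λ i → val σ i ℤ.< ℤ.+ 0)
      N? i = val σ i ℤ.<? ℤ.+ 0
      O? : Decidable (λ i → ¬ idx i ℤ.< val σ i × ¬ val σ i ≡ idx i × ¬ val σ i ≡ ℤ.- idx i)
      O? = none? E? F? S?
      E⇒¬F : ∀ {i} → idx i ℤ.< val σ i → val σ i ≢ idx i
      E⇒¬F lt eq = ℤP.<⇒≢ lt (≡.sym eq)
      E⇒¬S : ∀ {i} → idx i ℤ.< val σ i → val σ i ≢ ℤ.- idx i
      E⇒¬S {i} lt eq = ℤP.+≮- (≡.subst (idx i ℤ.<_) eq lt)
      F⇒¬S : ∀ {i} → val σ i ≡ idx i → val σ i ≢ ℤ.- idx i
      F⇒¬S eq eq′ = positive≢negative (≡.trans (≡.sym eq) eq′)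
      aexcA≡count : aexcA σ ≡ count O? (allFin n)
      aexcA≡count = ≡.trans (≡.cong (λ k → k Nat.∸ excA σ Nat.∸ fixB σ Nat.∸ single σ)
                                     (≡.sym (ListP.length-tabulate (λ i → i))))
                            (count-none E? F? S? E⇒¬F E⇒¬S F⇒¬S (allFin n))

    signed : ∀ {n} → Fin n × Bool → ℤ
    signed (k , false) = idx k
    signed (k , true)  = ℤ.- idx k

    val-signed : ∀ {n} (σ : SPerm n) i → val σ i ≡ signed (lookup σ i)
    val-signed σ i with lookup σ i
    ... | k , false = ≡.refl
    ... | k , true  = ≡.refl

    signedWeight : ∀ {n} → Fin n → Fin n × Bool → Carrier
    signedWeight i (k , false) = positionWeight (does (i Fin.<? k)) (does (k Fin.≟ i)) false false
    signedWeight i (k , true)  = positionWeight false false (does (k Fin.≟ i)) true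

    weightAt-signed : ∀ {n} (i : Fin n) e → weightAt i (signed e) ≡ signedWeight i e
    weightAt-signed i (k , false) =
      ≡.cong₂ (λ above fixed → positionWeight above fixed false false)
              (does-⇔ (mk⇔ idx-cancel-< idx-mono-<) (idx i ℤ.<? idx k) (i Fin.<? k))
              (does-⇔ (mk⇔ idx-injective (≡.cong idx)) (idx k ℤ.≟ idx i) (k Fin.≟ i))
    weightAt-signed i (k , true) =
      ≡.cong (λ opposite → positionWeight false false opposite true)
             (does-⇔ (mk⇔ (FinP.toℕ-injective ∘ ℤP.-[1+-injective) (≡.cong (λ j → ℤ.- idx j)))
                     (ℤ.- idx k ℤ.≟ ℤ.- idx i) (k Fin.≟ i))

    signed-statistics-product : ∀ {n} (σ : SPerm n) →
      pow x (excA σ) * pow y (aexcA σ) * pow s (single σ) * pow t (fixB σ) * pow p (neg σ)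
        ≈ ∏ (λ i → signedWeight i (lookup σ i))
    signed-statistics-product σ = trans (statistics-product σ) (reflexive (sum-cong-≗ (λ i →
      ≡.trans (≡.cong (weightAt i) (val-signed σ i)) (weightAt-signed i (lookup σ i)))))

    unsignedWeight : ∀ {n} → Fin n → Fin n → Carrier
    unsignedWeight i k =
      (x + p * y) ^ᵇ does (i Fin.<? k) * (y + p * y) ^ᵇ does (k Fin.<? i) * (t + s * p) ^ᵇ does (k Fin.≟ i)

    unsigned-statistics-product : ∀ {n} (π : Perm n) →
      pow (x + p * y) (exc π) * pow (y + p * y) (drop π) * pow (t + s * p) (fix π)
        ≈ ∏ (λ i → unsignedWeight i (lookup π i))
    unsigned-statistics-product {n} π = begin
      pow (x + p * y) (exc π) * pow (y + p * y) (drop π) * pow (t + s * p) (fix π)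
        ≈⟨ *-cong (*-cong (pow-count-allFin (λ i → i Fin.<? lookup π i) _)
                          (pow-count-allFin (λ i → lookup π i Fin.<? i) _))
                  (pow-count-allFin (λ i → lookup π i Fin.≟ i) _) ⟩
      _ ≈⟨ *-congʳ (∏-distrib-* {n} _ _) ⟨
      _ ≈⟨ ∏-distrib-* {n} _ _ ⟨
      ∏ (λ i → unsignedWeight i (lookup π i)) ∎

    sign-sum : ∀ {lt eq gt} → ExactlyOne lt eq gt →
      positionWeight lt eq false false + (positionWeight false false eq true + 0#)
        ≈ (x + p * y) ^ᵇ lt * (y + p * y) ^ᵇ gt * (t + s * p) ^ᵇ eq
    sign-sum first = solve 3 (λ x y p →
      x :* con 1 :* con 1 :* con 1 :* con 1 :+ (con 1 :* y :* con 1 :* con 1 :* p :+ con 0)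
        := (x :+ p :* y) :* con 1 :* con 1) refl x y p
    sign-sum second = solve 3 (λ s t p →
      con 1 :* con 1 :* con 1 :* t :* con 1 :+ (con 1 :* con 1 :* s :* con 1 :* p :+ con 0)
        := con 1 :* con 1 :* (t :+ s :* p)) refl s t p
    sign-sum third = solve 2 (λ y p →
      con 1 :* y :* con 1 :* con 1 :* con 1 :+ (con 1 :* y :* con 1 :* con 1 :* p :+ con 0)
        := con 1 :* (y :+ p :* y) :* con 1) refl y p

    signedWeight-sum : ∀ {n} (i k : Fin n) → sumL (λ b → signedWeight i (k , b)) (false ∷ true ∷ []) ≈ unsignedWeight i k
    signedWeight-sum i k = sign-sum (exactlyOne-<-≡-> i k)

    permWeight : ∀ {n} → Vec (Fin n) n → Carrier
    permWeight π = pow q (cyc π) when does (isPerm? π)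

    BnA≡RHS : ∀ n → BnA n x y s t p q ≈ RHS n x y s t p q
    BnA≡RHS n = begin
      BnA n x y s t p q
        ≈⟨ sumL-filter (isPerm? ∘ absPerm) _ (allVecs n signs) ⟩
      sumL (λ σ → _ when does (isPerm? (absPerm σ))) (allVecs n signs)
        ≈⟨ sumL-cong (allVecs n signs) (λ σ → trans (when-* (does (isPerm? (absPerm σ))) _ _)
                                                    (*-congˡ (signed-statistics-product σ))) ⟩
      sumL (λ σ → permWeight (absPerm σ) * ∏ (λ i → signedWeight i (lookup σ i))) (allVecs n signs)
        ≈⟨ sumL-allVecs-pairs (allFin n) (false ∷ true ∷ []) n permWeight signedWeight ⟩
      sumL (λ π → permWeight π * ∏ (λ i → sumL (λ b → signedWeight i (lookup π i , b)) (false ∷ true ∷ [])))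
           (allVecs n (allFin n))
        ≈⟨ sumL-cong (allVecs n (allFin n)) (λ π → *-congˡ (∏-cong (λ i → signedWeight-sum i (lookup π i)))) ⟩
      sumL (λ π → permWeight π * ∏ (λ i → unsignedWeight i (lookup π i))) (allVecs n (allFin n))
        ≈⟨ sumL-cong (allVecs n (allFin n)) (λ π → trans (when-* (does (isPerm? π)) _ _)
                                                         (*-congˡ (unsigned-statistics-product π))) ⟨
      sumL (λ π → _ when does (isPerm? π)) (allVecs n (allFin n))
        ≈⟨ sumL-filter isPerm? _ (allVecs n (allFin n)) ⟨
      RHS n x y s t p q ∎
      where
      signs : List (Fin n × Bool)
      signs = concatMap (λ k → map (k ,_) (false ∷ true ∷ [])) (allFin n)

-- The identity holds for n = 0 as well.
theorem31 : ∀ {c ℓ} (R : CommutativeRing c ℓ) (n : ℕ) → n ≥ 1 →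
    (x y s t p q : CommutativeRing.Carrier R) →
    CommutativeRing._≈_ R (RingOps.BnA R n x y s t p q) (RingOps.RHS R n x y s t p q)
theorem31 R n _ x y s t p q = BnA≡RHS R x y s t p q n
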